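{- Let $M$ be a de Morgan algebra, $D$ a bounded distributive lattice, and $A$ a sublattice of $\mathrm{Con}(M)\times\mathrm{Con}(D)$. Then $A$ is representable if and only if there exists a lattice $(0,1)$-homomorphism $\varphi: M\to D$ such that for every $\theta_1\in\mathrm{Con}(M)$ and every $\theta_2\in\mathrm{Con}(D)$, $$(\theta_1,\theta_2)\in A\iff \mathrm{Con}(\varphi)(\theta_1)\subseteq\theta_2.$$
   Context: An MS-algebra is an algebra $(L;\vee,\wedge,{}^{\circ},0,1)$ where $(L;\vee,\wedge,0,1)$ is a bounded distributive lattice and ${}^{\circ}$ is a unary operation with $x\le x^{\circ\circ}$, $(x\wedge y)^{\circ}=x^{\circ}\vee y^{\circ}$ and $1^{\circ}=0$; a de Morgan algebra is an MS-algebra with $x=x^{\circ\circ}$. For an MS-algebra $L$: $L^{\circ\circ}=\{x\mid x=x^{\circ\circ}\}$ (a de Morgan subalgebra), $D(L)=\{x\mid x^{\circ}=0\}$ (a filter). $L$ is principal if there is $d_L$ with $D(L)=\{x\mid x\ge d_L\}$ and $x=x^{\circ\circ}\wedge(x\vee d_L)$ for all $x$; then $D(L)$ is a bounded distributive lattice with bounds $d_L,1$. An MS-congruence pair of a principal MS-algebra $L$ is $(\theta_1,\theta_2)\in\mathrm{Con}(L^{\circ\circ})\times\mathrm{Con}(D(L))$ (de Morgan algebra congruences, resp. lattice congruences) such that $(a,b)\in\theta_1$ implies $(a\vee d_L,b\vee d_L)\in\theta_2$; $A(L)$ is the set of these. For a homomorphism $\tau:X\to Y$ and $\theta\in\mathrm{Con}(X)$,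 $\mathrm{Con}(\tau)(\theta)$ is the congruence of $Y$ generated by all pairs $(\tau(x),\tau(y))$, $(x,y)\in\theta$. A subset $A\subseteq\mathrm{Con}(M)\times\mathrm{Con}(D)$ is representable if there exist a principal MS-algebra $L$, a de Morgan algebra isomorphism $\tau_1:M\to L^{\circ\circ}$ and a bounded lattice isomorphism $\tau_2:D\to D(L)$ such that $A=\{(\theta_1,\theta_2)\mid(\mathrm{Con}(\tau_1)(\theta_1),\mathrm{Con}(\tau_2)(\theta_2))\in A(L)\}$. -}

module Defs where

open import Level using (Level; suc; _⊔_)
open import Data.Product using (Σ; Σ-syntax; ∃; ∃-syntax; _×_; _,_; proj₁; proj₂)
open import Data.Sum using (_⊎_; inj₁; inj₂)
open import Relation.Binary.Core using (Rel; _⇒_)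
open import Relation.Binary.Structures using (IsEquivalence)
open import Relation.Binary.Bundles using (Setoid)
open import Relation.Unary using (Pred)
open import Function.Bundles using (_⇔_)
open import Algebra.Core using (Op₁; Op₂)
open import Algebra.Lattice.Structures using (IsLattice; IsDistributiveLattice)
import Algebra.Definitions as AD
import Relation.Binary.Reasoning.Setoid as SetoidReasoning

private
  variable
    ℓ : Level

record BDLattice ℓ : Set (suc ℓ) where
  infixr 7 _∧_
  infixr 6 _∨_
  infix  4 _≈_ _≤_
  field
    Carrier               : Set ℓ
    _≈_                   : Rel Carrier ℓ
    _∨_                   : Op₂ Carrier
    _∧_                   : Op₂ Carrier
    𝟘                     : Carrier
    𝟙                     : Carrier
    isDistributiveLattice : IsDistributiveLattice _≈_ _∨_ _∧_
    ∨-identityʳ           : AD.RightIdentity _≈_ 𝟘 _∨_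
    ∧-identityʳ           : AD.RightIdentity _≈_ 𝟙 _∧_

  open IsDistributiveLattice isDistributiveLattice public

  _≤_ : Rel Carrier ℓ
  x ≤ y = x ∧ y ≈ x

  setoid : Setoid ℓ ℓ
  setoid = record { isEquivalence = isEquivalence }

record MSAlgebra ℓ : Set (suc ℓ) where
  infix 8 _°
  field
    lattice : BDLattice ℓ
  open BDLattice lattice public
  field
    _°      : Op₁ Carrier
    °-cong  : AD.Congruent₁ _≈_ _°
    ≤-°°    : ∀ x → x ≤ x ° °
    °-∧     : ∀ x y → (x ∧ y) ° ≈ x ° ∨ y °
    𝟙°      : 𝟙 ° ≈ 𝟘

record DeMorganAlgebra ℓ : Set (suc ℓ) where
  field
    msAlgebra : MSAlgebra ℓ
  open MSAlgebra msAlgebra public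
  field
    °°-involutive : ∀ x → x ° ° ≈ x

module LatticeFacts (K : BDLattice ℓ) where
  open BDLattice K
  open SetoidReasoning setoid

  ≈⇒≤ : ∀ {x y} → x ≈ y → x ≤ y
  ≈⇒≤ {x} {y} x≈y = begin
    x ∧ y ≈⟨ ∧-congˡ (sym x≈y) ⟩
    x ∧ x ≈⟨ ∧-congˡ (sym (∨-identityʳ x)) ⟩
    x ∧ (x ∨ 𝟘) ≈⟨ ∧-absorbs-∨ x 𝟘 ⟩
    x ∎

  ≤-antisym : ∀ {x y} → x ≤ y → y ≤ x → x ≈ y
  ≤-antisym {x} {y} p q = begin
    x ≈⟨ sym p ⟩ x ∧ y ≈⟨ ∧-comm x y ⟩ y ∧ x ≈⟨ q ⟩ y ∎

  ≤-trans : ∀ {x y z} → x ≤ y → y ≤ z → x ≤ z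
  ≤-trans {x} {y} {z} p q = begin
    x ∧ z ≈⟨ ∧-congʳ (sym p) ⟩
    (x ∧ y) ∧ z ≈⟨ ∧-assoc x y z ⟩
    x ∧ (y ∧ z) ≈⟨ ∧-congˡ q ⟩
    x ∧ y ≈⟨ p ⟩
    x ∎

  ≤-glb : ∀ {x y z} → z ≤ x → z ≤ y → z ≤ x ∧ y
  ≤-glb {x} {y} {z} p q = begin
    z ∧ (x ∧ y) ≈⟨ sym (∧-assoc z x y) ⟩
    (z ∧ x) ∧ y ≈⟨ ∧-congʳ p ⟩
    z ∧ y ≈⟨ q ⟩
    z ∎

  ≤-lub : ∀ {x y z} → x ≤ z → y ≤ z → x ∨ y ≤ z
  ≤-lub {x} {y} {z} p q = begin
    (x ∨ y) ∧ z ≈⟨ ∧-distribʳ-∨ z x y ⟩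
    (x ∧ z) ∨ (y ∧ z) ≈⟨ ∨-cong p q ⟩
    x ∨ y ∎

  x≤x∨y : ∀ x y → x ≤ x ∨ y
  x≤x∨y x y = ∧-absorbs-∨ x y

  y≤x∨y : ∀ x y → y ≤ x ∨ y
  y≤x∨y x y = ≤-trans (x≤x∨y y x) (≈⇒≤ (∨-comm y x))

  x∧y≤x : ∀ x y → x ∧ y ≤ x
  x∧y≤x x y = begin
    (x ∧ y) ∧ x ≈⟨ ∧-comm (x ∧ y) x ⟩
    x ∧ (x ∧ y) ≈⟨ sym (∧-assoc x x y) ⟩
    (x ∧ x) ∧ y ≈⟨ ∧-congʳ (≈⇒≤ refl) ⟩
    x ∧ y ∎

  x≤𝟙 : ∀ x → x ≤ 𝟙
  x≤𝟙 x = ∧-identityʳ x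

  𝟘≤x : ∀ x → 𝟘 ≤ x
  𝟘≤x x = begin
    𝟘 ∧ x ≈⟨ ∧-congˡ (sym (∨-identityʳ x)) ⟩
    𝟘 ∧ (x ∨ 𝟘) ≈⟨ ∧-congˡ (∨-comm x 𝟘) ⟩
    𝟘 ∧ (𝟘 ∨ x) ≈⟨ ∧-absorbs-∨ 𝟘 x ⟩
    𝟘 ∎

  x∧𝟘 : ∀ x → x ∧ 𝟘 ≈ 𝟘
  x∧𝟘 x = trans (∧-comm x 𝟘) (𝟘≤x x)

  ≤⇒∨ : ∀ {x y} → x ≤ y → y ∨ x ≈ y
  ≤⇒∨ {x} {y} p = begin
    y ∨ x ≈⟨ ∨-congˡ (sym p) ⟩
    y ∨ (x ∧ y) ≈⟨ ∨-congˡ (∧-comm x y) ⟩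
    y ∨ (y ∧ x) ≈⟨ ∨-absorbs-∧ y x ⟩
    y ∎

module Restrict (K : BDLattice ℓ) {ℓp} (P : BDLattice.Carrier K → Set ℓp)
  where
  open BDLattice K

  S : Set (ℓ ⊔ ℓp)
  S = Σ Carrier P

  _≈S_ : Rel S ℓ
  a ≈S b = proj₁ a ≈ proj₁ b

  isDL : (∨P : ∀ {x y} → P x → P y → P (x ∨ y))
         (∧P : ∀ {x y} → P x → P y → P (x ∧ y)) →
         IsDistributiveLattice _≈S_
           (λ a b → (proj₁ a ∨ proj₁ b) , ∨P (proj₂ a) (proj₂ b))
           (λ a b → (proj₁ a ∧ proj₁ b) , ∧P (proj₂ a) (proj₂ b))
  isDL ∨P ∧P = record
    { isLattice = record
      { isEquivalence = record { refl = refl ; sym = sym ; trans = trans }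
      ; ∨-comm = λ a b → ∨-comm (proj₁ a) (proj₁ b)
      ; ∨-assoc = λ a b c → ∨-assoc (proj₁ a) (proj₁ b) (proj₁ c)
      ; ∨-cong = ∨-cong
      ; ∧-comm = λ a b → ∧-comm (proj₁ a) (proj₁ b)
      ; ∧-assoc = λ a b c → ∧-assoc (proj₁ a) (proj₁ b) (proj₁ c)
      ; ∧-cong = ∧-cong
      ; absorptive = (λ a b → ∨-absorbs-∧ (proj₁ a) (proj₁ b))
                   , (λ a b → ∧-absorbs-∨ (proj₁ a) (proj₁ b))
      }
    ; ∨-distrib-∧ = (λ a b c → ∨-distribˡ-∧ (proj₁ a) (proj₁ b) (proj₁ c))
                  , (λ a b c → ∨-distribʳ-∧ (proj₁ a) (proj₁ b) (proj₁ c))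
    ; ∧-distrib-∨ = (λ a b c → ∧-distribˡ-∨ (proj₁ a) (proj₁ b) (proj₁ c))
                  , (λ a b c → ∧-distribʳ-∨ (proj₁ a) (proj₁ b) (proj₁ c))
    }

module MSFacts (L : MSAlgebra ℓ) where
  open MSAlgebra L
  open LatticeFacts lattice
  open SetoidReasoning setoid

  °-antitone : ∀ {x y} → x ≤ y → y ° ≤ x °
  °-antitone {x} {y} p = begin
    y ° ∧ x ° ≈⟨ ∧-congˡ (°-cong (sym p)) ⟩
    y ° ∧ (x ∧ y) ° ≈⟨ ∧-congˡ (°-∧ x y) ⟩
    y ° ∧ (x ° ∨ y °) ≈⟨ ∧-congˡ (∨-comm (x °) (y °)) ⟩
    y ° ∧ (y ° ∨ x °) ≈⟨ ∧-absorbs-∨ (y °) (x °) ⟩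
    y ° ∎

  °-∨ : ∀ x y → (x ∨ y) ° ≈ x ° ∧ y °
  °-∨ x y = ≤-antisym
    (≤-glb (°-antitone (x≤x∨y x y)) (°-antitone (y≤x∨y x y)))
    (≤-trans (≤-°° (x ° ∧ y °))
      (≤-trans (≈⇒≤ (°-cong (°-∧ (x °) (y °))))
        (°-antitone (≤-lub (≤-trans (≤-°° x) (x≤x∨y (x ° °) (y ° °)))
                           (≤-trans (≤-°° y) (y≤x∨y (x ° °) (y ° °)))))))

  𝟘° : 𝟘 ° ≈ 𝟙
  𝟘° = ≤-antisym (x≤𝟙 (𝟘 °)) (≤-trans (≤-°° 𝟙) (≈⇒≤ (°-cong 𝟙°)))

module _ (L : MSAlgebra ℓ) where
  open MSAlgebra L
  open MSFacts L
  open SetoidReasoning setoid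

  IsClosed : Carrier → Set ℓ
  IsClosed x = x ≈ x ° °

  private
    ∨-closed : ∀ {x y} → IsClosed x → IsClosed y → IsClosed (x ∨ y)
    ∨-closed {x} {y} p q = sym (begin
      (x ∨ y) ° ° ≈⟨ °-cong (°-∨ x y) ⟩
      (x ° ∧ y °) ° ≈⟨ °-∧ (x °) (y °) ⟩
      x ° ° ∨ y ° ° ≈⟨ ∨-cong (sym p) (sym q) ⟩
      x ∨ y ∎)

    ∧-closed : ∀ {x y} → IsClosed x → IsClosed y → IsClosed (x ∧ y)
    ∧-closed {x} {y} p q = sym (begin
      (x ∧ y) ° ° ≈⟨ °-cong (°-∧ x y) ⟩
      (x ° ∨ y °) ° ≈⟨ °-∨ (x °) (y °) ⟩
      x ° ° ∧ y ° ° ≈⟨ ∧-cong (sym p) (sym q) ⟩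
      x ∧ y ∎)

  open Restrict lattice IsClosed

  L°° : DeMorganAlgebra ℓ
  L°° = record
    { msAlgebra = record
      { lattice = record
        { Carrier = S
        ; _≈_ = _≈S_
        ; _∨_ = λ a b → (proj₁ a ∨ proj₁ b) , ∨-closed (proj₂ a) (proj₂ b)
        ; _∧_ = λ a b → (proj₁ a ∧ proj₁ b) , ∧-closed (proj₂ a) (proj₂ b)
        ; 𝟘 = 𝟘 , sym (trans (°-cong 𝟘°) 𝟙°)
        ; 𝟙 = 𝟙 , sym (trans (°-cong 𝟙°) 𝟘°)
        ; isDistributiveLattice = isDL ∨-closed ∧-closed
        ; ∨-identityʳ = λ a → ∨-identityʳ (proj₁ a)
        ; ∧-identityʳ = λ a → ∧-identityʳ (proj₁ a)
        }
      ; _° = λ a → (proj₁ a °) , °-cong (proj₂ a)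
      ; °-cong = °-cong
      ; ≤-°° = λ a → ≤-°° (proj₁ a)
      ; °-∧ = λ a b → °-∧ (proj₁ a) (proj₁ b)
      ; 𝟙° = 𝟙°
      }
    ; °°-involutive = λ a → sym (proj₂ a)
    }

record Principal (L : MSAlgebra ℓ) : Set ℓ where
  open MSAlgebra L
  field
    d          : Carrier
    D-is-↑d    : ∀ x → (x ° ≈ 𝟘 → d ≤ x) × (d ≤ x → x ° ≈ 𝟘)
    decompose  : ∀ x → x ≈ x ° ° ∧ (x ∨ d)

module _ {L : MSAlgebra ℓ} (pr : Principal L) where
  open MSAlgebra L
  open Principal pr
  open MSFacts L
  open LatticeFacts lattice
  open SetoidReasoning setoid

  InD : Carrier → Set ℓ
  InD x = x ° ≈ 𝟘

  private
    ∨-D : ∀ {x y} → InD x → InD y → InD (x ∨ y)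
    ∨-D {x} {y} p q = trans (°-∨ x y) (trans (∧-congˡ q) (x∧𝟘 (x °)))

    ∧-D : ∀ {x y} → InD x → InD y → InD (x ∧ y)
    ∧-D {x} {y} p q = trans (°-∧ x y) (trans (∨-cong p q) (∨-identityʳ 𝟘))

  open Restrict lattice InD

  DL : BDLattice ℓ
  DL = record
    { Carrier = S
    ; _≈_ = _≈S_
    ; _∨_ = λ a b → (proj₁ a ∨ proj₁ b) , ∨-D (proj₂ a) (proj₂ b)
    ; _∧_ = λ a b → (proj₁ a ∧ proj₁ b) , ∧-D (proj₂ a) (proj₂ b)
    ; 𝟘 = d , proj₂ (D-is-↑d d) (≈⇒≤ refl)
    ; 𝟙 = 𝟙 , 𝟙°
    ; isDistributiveLattice = isDL ∨-D ∧-D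
    ; ∨-identityʳ = λ a → ≤⇒∨ (proj₁ (D-is-↑d (proj₁ a)) (proj₂ a))
    ; ∧-identityʳ = λ a → ∧-identityʳ (proj₁ a)
    }

  ∨d : MSAlgebra.Carrier (DeMorganAlgebra.msAlgebra (L°° L)) → BDLattice.Carrier DL
  ∨d a = (proj₁ a ∨ d) , trans (°-∨ (proj₁ a) d)
           (trans (∧-congˡ (proj₂ (D-is-↑d d) (≈⇒≤ refl))) (x∧𝟘 (proj₁ a °)))

record LatCon (K : BDLattice ℓ) : Set (suc ℓ) where
  open BDLattice K
  field
    rel           : Rel Carrier ℓ
    isEquivalence : IsEquivalence rel
    ≈⊆rel         : _≈_ ⇒ rel
    ∨-compat      : ∀ {x y u v} → rel x y → rel u v → rel (x ∨ u) (y ∨ v)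
    ∧-compat      : ∀ {x y u v} → rel x y → rel u v → rel (x ∧ u) (y ∧ v)

record MSCon (L : MSAlgebra ℓ) : Set (suc ℓ) where
  open MSAlgebra L
  field
    latCon   : LatCon lattice
  open LatCon latCon public
  field
    °-compat : ∀ {x y} → rel x y → rel (x °) (y °)

Con : DeMorganAlgebra ℓ → Set (suc ℓ)
Con M = MSCon (DeMorganAlgebra.msAlgebra M)

ConL : BDLattice ℓ → Set (suc ℓ)
ConL D = LatCon D

data LatGen (K : BDLattice ℓ) (R : Rel (BDLattice.Carrier K) ℓ) :
            Rel (BDLattice.Carrier K) ℓ where
  base  : ∀ {x y} → R x y → LatGen K R x y
  eq    : ∀ {x y} → BDLattice._≈_ K x y → LatGen K R x y
  sym   : ∀ {x y} → LatGen K R x y → LatGen K R y x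
  trans : ∀ {x y z} → LatGen K R x y → LatGen K R y z → LatGen K R x z
  ∨-c   : ∀ {x y u v} → LatGen K R x y → LatGen K R u v →
          LatGen K R (BDLattice._∨_ K x u) (BDLattice._∨_ K y v)
  ∧-c   : ∀ {x y u v} → LatGen K R x y → LatGen K R u v →
          LatGen K R (BDLattice._∧_ K x u) (BDLattice._∧_ K y v)

latGen : (K : BDLattice ℓ) → Rel (BDLattice.Carrier K) ℓ → LatCon K
latGen K R = record
  { rel = LatGen K R
  ; isEquivalence = record { refl = eq (BDLattice.refl K) ; sym = sym ; trans = trans }
  ; ≈⊆rel = eq
  ; ∨-compat = ∨-c
  ; ∧-compat = ∧-c
  }

data MSGen (L : MSAlgebra ℓ) (R : Rel (MSAlgebra.Carrier L) ℓ) :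
           Rel (MSAlgebra.Carrier L) ℓ where
  base  : ∀ {x y} → R x y → MSGen L R x y
  eq    : ∀ {x y} → MSAlgebra._≈_ L x y → MSGen L R x y
  sym   : ∀ {x y} → MSGen L R x y → MSGen L R y x
  trans : ∀ {x y z} → MSGen L R x y → MSGen L R y z → MSGen L R x z
  ∨-c   : ∀ {x y u v} → MSGen L R x y → MSGen L R u v →
          MSGen L R (MSAlgebra._∨_ L x u) (MSAlgebra._∨_ L y v)
  ∧-c   : ∀ {x y u v} → MSGen L R x y → MSGen L R u v →
          MSGen L R (MSAlgebra._∧_ L x u) (MSAlgebra._∧_ L y v)
  °-c   : ∀ {x y} → MSGen L R x y →
          MSGen L R (MSAlgebra._° L x) (MSAlgebra._° L y)

msGen : (L : MSAlgebra ℓ) → Rel (MSAlgebra.Carrier L) ℓ → MSCon L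
msGen L R = record
  { latCon = record
    { rel = MSGen L R
    ; isEquivalence = record { refl = eq (MSAlgebra.refl L) ; sym = sym ; trans = trans }
    ; ≈⊆rel = eq
    ; ∨-compat = ∨-c
    ; ∧-compat = ∧-c
    }
  ; °-compat = °-c
  }

data Image {A B : Set ℓ} (f : A → B) (R : Rel A ℓ) : Rel B ℓ where
  img : ∀ {x y} → R x y → Image f R (f x) (f y)

ConMapL : {A : Set ℓ} (K : BDLattice ℓ) → (A → BDLattice.Carrier K) →
          Rel A ℓ → LatCon K
ConMapL K f R = latGen K (Image f R)

ConMapDM : {A : Set ℓ} (N : DeMorganAlgebra ℓ) →
           (A → MSAlgebra.Carrier (DeMorganAlgebra.msAlgebra N)) →
           Rel A ℓ → Con N
ConMapDM N f R = msGen (DeMorganAlgebra.msAlgebra N) (Image f R)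

record IsLat01Hom (K K′ : BDLattice ℓ)
                  (f : BDLattice.Carrier K → BDLattice.Carrier K′) : Set ℓ where
  private
    module K  = BDLattice K
    module K′ = BDLattice K′
  field
    cong   : ∀ {x y} → x K.≈ y → f x K′.≈ f y
    ∨-hom  : ∀ x y → f (x K.∨ y) K′.≈ (f x K′.∨ f y)
    ∧-hom  : ∀ x y → f (x K.∧ y) K′.≈ (f x K′.∧ f y)
    𝟘-hom  : f K.𝟘 K′.≈ K′.𝟘
    𝟙-hom  : f K.𝟙 K′.≈ K′.𝟙

record IsLat01Iso (K K′ : BDLattice ℓ)
                  (f : BDLattice.Carrier K → BDLattice.Carrier K′) : Set ℓ where
  private
    module K  = BDLattice K
    module K′ = BDLattice K′
  field
    isHom      : IsLat01Hom K K′ f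
    injective  : ∀ {x y} → f x K′.≈ f y → x K.≈ y
    surjective : ∀ z → ∃[ x ] (f x K′.≈ z)

record IsDMIso (N N′ : DeMorganAlgebra ℓ)
               (f : DeMorganAlgebra.Carrier N → DeMorganAlgebra.Carrier N′) : Set ℓ where
  private
    module N  = DeMorganAlgebra N
    module N′ = DeMorganAlgebra N′
  field
    isLatHom   : IsLat01Hom N.lattice N′.lattice f
    °-hom      : ∀ x → f (x N.°) N′.≈ (f x N′.°)
    injective  : ∀ {x y} → f x N′.≈ f y → x N.≈ y
    surjective : ∀ z → ∃[ x ] (f x N′.≈ z)

InA : {L : MSAlgebra ℓ} (pr : Principal L) →
      Con (L°° L) → ConL (DL pr) → Set ℓ
InA pr θ₁ θ₂ = ∀ a b → MSCon.rel θ₁ a b → LatCon.rel θ₂ (∨d pr a) (∨d pr b)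

module _ {M : DeMorganAlgebra ℓ} where
  _⊓M_ : Con M → Con M → Con M
  θ ⊓M ψ = record
    { latCon = record
      { rel = λ x y → MSCon.rel θ x y × MSCon.rel ψ x y
      ; isEquivalence = record
        { refl = IsEquivalence.refl (MSCon.isEquivalence θ) , IsEquivalence.refl (MSCon.isEquivalence ψ)
        ; sym = λ p → IsEquivalence.sym (MSCon.isEquivalence θ) (proj₁ p) , IsEquivalence.sym (MSCon.isEquivalence ψ) (proj₂ p)
        ; trans = λ p q → IsEquivalence.trans (MSCon.isEquivalence θ) (proj₁ p) (proj₁ q) , IsEquivalence.trans (MSCon.isEquivalence ψ) (proj₂ p) (proj₂ q)
        }
      ; ≈⊆rel = λ e → MSCon.≈⊆rel θ e , MSCon.≈⊆rel ψ e
      ; ∨-compat = λ p q → MSCon.∨-compat θ (proj₁ p) (proj₁ q) , MSCon.∨-compat ψ (proj₂ p) (proj₂ q)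
      ; ∧-compat = λ p q → MSCon.∧-compat θ (proj₁ p) (proj₁ q) , MSCon.∧-compat ψ (proj₂ p) (proj₂ q)
      }
    ; °-compat = λ p → MSCon.°-compat θ (proj₁ p) , MSCon.°-compat ψ (proj₂ p)
    }

  _⊔M_ : Con M → Con M → Con M
  θ ⊔M ψ = msGen (DeMorganAlgebra.msAlgebra M) (λ x y → MSCon.rel θ x y ⊎ MSCon.rel ψ x y)

module _ {D : BDLattice ℓ} where
  _⊓D_ : ConL D → ConL D → ConL D
  θ ⊓D ψ = record
    { rel = λ x y → LatCon.rel θ x y × LatCon.rel ψ x y
    ; isEquivalence = record
      { refl = IsEquivalence.refl (LatCon.isEquivalence θ) , IsEquivalence.refl (LatCon.isEquivalence ψ)
      ; sym = λ p → IsEquivalence.sym (LatCon.isEquivalence θ) (proj₁ p) , IsEquivalence.sym (LatCon.isEquivalence ψ) (proj₂ p)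
      ; trans = λ p q → IsEquivalence.trans (LatCon.isEquivalence θ) (proj₁ p) (proj₁ q) , IsEquivalence.trans (LatCon.isEquivalence ψ) (proj₂ p) (proj₂ q)
      }
    ; ≈⊆rel = λ e → LatCon.≈⊆rel θ e , LatCon.≈⊆rel ψ e
    ; ∨-compat = λ p q → LatCon.∨-compat θ (proj₁ p) (proj₁ q) , LatCon.∨-compat ψ (proj₂ p) (proj₂ q)
    ; ∧-compat = λ p q → LatCon.∧-compat θ (proj₁ p) (proj₁ q) , LatCon.∧-compat ψ (proj₂ p) (proj₂ q)
    }

  _⊔D_ : ConL D → ConL D → ConL D
  θ ⊔D ψ = latGen D (λ x y → LatCon.rel θ x y ⊎ LatCon.rel ψ x y)

IsSublattice : {M : DeMorganAlgebra ℓ} {D : BDLattice ℓ} {ℓa : Level} →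
               Pred (Con M × ConL D) ℓa → Set (suc ℓ ⊔ ℓa)
IsSublattice {M = M} {D} A =
  ∀ θ₁ θ₂ ψ₁ ψ₂ → A (θ₁ , θ₂) → A (ψ₁ , ψ₂) →
    A (_⊓M_ {M = M} θ₁ ψ₁ , _⊓D_ {D = D} θ₂ ψ₂) ×
    A (_⊔M_ {M = M} θ₁ ψ₁ , _⊔D_ {D = D} θ₂ ψ₂)

Representable : {M : DeMorganAlgebra ℓ} {D : BDLattice ℓ} {ℓa : Level} →
                Pred (Con M × ConL D) ℓa → Set (suc ℓ ⊔ ℓa)
Representable {ℓ = ℓ} {M = M} {D} A =
  Σ[ L ∈ MSAlgebra ℓ ] Σ[ pr ∈ Principal L ]
  Σ[ τ₁ ∈ (DeMorganAlgebra.Carrier M → DeMorganAlgebra.Carrier (L°° L)) ]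
  Σ[ τ₂ ∈ (BDLattice.Carrier D → BDLattice.Carrier (DL pr)) ]
    IsDMIso M (L°° L) τ₁ × IsLat01Iso D (DL pr) τ₂ ×
    (∀ (θ₁ : Con M) (θ₂ : ConL D) →
       A (θ₁ , θ₂) ⇔ InA pr (ConMapDM (L°° L) τ₁ (MSCon.rel θ₁))
                            (ConMapL (DL pr) τ₂ (LatCon.rel θ₂)))

module Submission where

-- The proof rests on one transport lemma.  Given isomorphisms τ₁ : M ≅ N
-- (de Morgan) and τ₂ : D ≅ E (lattices) and a map g : N → E, the condition
-- "g maps Con(τ₁)(θ₁)-related pairs to Con(τ₂)(θ₂)-related pairs" is equivalent
-- to Con(τ₂⁻¹ ∘ g ∘ τ₁)(θ₁) ⊆ θ₂.  It follows from the universal property of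
-- generated congruences and from the fact that transporting a congruence along
-- an isomorphism amounts to pulling pairs back along the inverse.
--
-- (⇒) For a representation (L, τ₁, τ₂), take g = (− ∨ d_L) : L°° → D(L), a
--     (0,1)-homomorphism, and φ = τ₂⁻¹ ∘ g ∘ τ₁; A(L) is exactly the condition
--     on the left of the transport lemma.
-- (⇐) For φ, the algebra L = {(a,x) ∈ M × D | x ≤ φ a} with (a,x)° = (a°, φ a°)
--     is principal with d_L = (1,0); a ↦ (a, φ a) is an isomorphism M ≅ L°°,
--     x ↦ (1,x) is an isomorphism D ≅ D(L), and the induced map τ₂⁻¹ ∘ g ∘ τ₁
--     is pointwise equal to φ, so the transport lemma applies again.

open import Defs
open import Level using (Level; suc; _⊔_)
open import Data.Product using (Σ-syntax; _×_; _,_; proj₁; proj₂)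
open import Relation.Binary.Core using (Rel; _⇒_)
open import Relation.Binary.Structures using (IsEquivalence)
open import Relation.Unary using (Pred)
open import Function.Bundles using (_⇔_; mk⇔; Equivalence)
import Function.Properties.Equivalence as ⇔
import Relation.Binary.Reasoning.Setoid as SetoidReasoning

private
  variable
    ℓ : Level

rel-resp : {K : BDLattice ℓ} (θ : LatCon K) {x y x′ y′ : BDLattice.Carrier K} →
           BDLattice._≈_ K x x′ → BDLattice._≈_ K y y′ →
           LatCon.rel θ x y → LatCon.rel θ x′ y′
rel-resp {K = K} θ x≈x′ y≈y′ r =
  Eq.trans (≈⊆rel (BDLattice.sym K x≈x′)) (Eq.trans r (≈⊆rel y≈y′))
  where open LatCon θ
        module Eq = IsEquivalence isEquivalence

conMap⊆⇔ : {A : Set ℓ} (K : BDLattice ℓ) (f : A → BDLattice.Carrier K)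
           (R : Rel A ℓ) (θ : LatCon K) →
           (LatCon.rel (ConMapL K f R) ⇒ LatCon.rel θ)
           ⇔ (∀ {a b} → R a b → LatCon.rel θ (f a) (f b))
conMap⊆⇔ K f R θ = mk⇔ generators⊆ generated⊆
  where
  open LatCon θ
  module Eq = IsEquivalence isEquivalence
  generators⊆ : LatGen K (Image f R) ⇒ rel → ∀ {a b} → R a b → rel (f a) (f b)
  generators⊆ h r = h (base (img r))
  generated⊆ : (∀ {a b} → R a b → rel (f a) (f b)) → LatGen K (Image f R) ⇒ rel
  generated⊆ h (base (img r)) = h r
  generated⊆ h (eq e)         = ≈⊆rel e
  generated⊆ h (sym p)        = Eq.sym (generated⊆ h p)
  generated⊆ h (trans p q)    = Eq.trans (generated⊆ h p) (generated⊆ h q)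
  generated⊆ h (∨-c p q)      = ∨-compat (generated⊆ h p) (generated⊆ h q)
  generated⊆ h (∧-c p q)      = ∧-compat (generated⊆ h p) (generated⊆ h q)

conMap⊆-resp : {A : Set ℓ} (K : BDLattice ℓ) (f g : A → BDLattice.Carrier K) →
               (∀ a → BDLattice._≈_ K (f a) (g a)) → (R : Rel A ℓ) (θ : LatCon K) →
               (LatCon.rel (ConMapL K f R) ⇒ LatCon.rel θ)
               ⇔ (LatCon.rel (ConMapL K g R) ⇒ LatCon.rel θ)
conMap⊆-resp K f g f≈g R θ =
  ⇔.trans (conMap⊆⇔ K f R θ)
    (⇔.trans (mk⇔ (λ h {_} {_} r → rel-resp θ (f≈g _) (f≈g _) (h r))
                  (λ h {_} {_} r → rel-resp θ (K.sym (f≈g _)) (K.sym (f≈g _)) (h r)))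
             (⇔.sym (conMap⊆⇔ K g R θ)))
  where module K = BDLattice K

∘-hom : {K₁ K₂ K₃ : BDLattice ℓ}
        {f : BDLattice.Carrier K₁ → BDLattice.Carrier K₂}
        {g : BDLattice.Carrier K₂ → BDLattice.Carrier K₃} →
        IsLat01Hom K₁ K₂ f → IsLat01Hom K₂ K₃ g → IsLat01Hom K₁ K₃ (λ x → g (f x))
∘-hom {K₃ = K₃} hf hg = record
  { cong  = λ e → G.cong (F.cong e)
  ; ∨-hom = λ x y → K₃.trans (G.cong (F.∨-hom x y)) (G.∨-hom _ _)
  ; ∧-hom = λ x y → K₃.trans (G.cong (F.∧-hom x y)) (G.∧-hom _ _)
  ; 𝟘-hom = K₃.trans (G.cong F.𝟘-hom) G.𝟘-hom
  ; 𝟙-hom = K₃.trans (G.cong F.𝟙-hom) G.𝟙-hom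
  }
  where module F = IsLat01Hom hf
        module G = IsLat01Hom hg
        module K₃ = BDLattice K₃

module LatIsoInverse {K K′ : BDLattice ℓ}
                     {τ : BDLattice.Carrier K → BDLattice.Carrier K′}
                     (iso : IsLat01Iso K K′ τ) where
  private
    module K  = BDLattice K
    module K′ = BDLattice K′
  open IsLat01Iso iso
  open IsLat01Hom isHom
  open SetoidReasoning K′.setoid

  σ : K′.Carrier → K.Carrier
  σ z = proj₁ (surjective z)

  τσ : ∀ z → τ (σ z) K′.≈ z
  τσ z = proj₂ (surjective z)

  στ : ∀ x → σ (τ x) K.≈ x
  στ x = injective (τσ (τ x))

  σ-cong : ∀ {x y} → x K′.≈ y → σ x K.≈ σ y
  σ-cong {x} {y} x≈y = injective (begin
    τ (σ x) ≈⟨ τσ x ⟩ x ≈⟨ x≈y ⟩ y ≈⟨ K′.sym (τσ y) ⟩ τ (σ y) ∎)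

  σ-∨ : ∀ x y → σ (x K′.∨ y) K.≈ σ x K.∨ σ y
  σ-∨ x y = injective (begin
    τ (σ (x K′.∨ y))      ≈⟨ τσ _ ⟩
    x K′.∨ y              ≈⟨ K′.∨-cong (K′.sym (τσ x)) (K′.sym (τσ y)) ⟩
    τ (σ x) K′.∨ τ (σ y)  ≈⟨ K′.sym (∨-hom _ _) ⟩
    τ (σ x K.∨ σ y)       ∎)

  σ-∧ : ∀ x y → σ (x K′.∧ y) K.≈ σ x K.∧ σ y
  σ-∧ x y = injective (begin
    τ (σ (x K′.∧ y))      ≈⟨ τσ _ ⟩
    x K′.∧ y              ≈⟨ K′.∧-cong (K′.sym (τσ x)) (K′.sym (τσ y)) ⟩
    τ (σ x) K′.∧ τ (σ y)  ≈⟨ K′.sym (∧-hom _ _) ⟩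
    τ (σ x K.∧ σ y)       ∎)

  σ-hom : IsLat01Hom K′ K σ
  σ-hom = record
    { cong  = σ-cong
    ; ∨-hom = σ-∨
    ; ∧-hom = σ-∧
    ; 𝟘-hom = injective (K′.trans (τσ _) (K′.sym 𝟘-hom))
    ; 𝟙-hom = injective (K′.trans (τσ _) (K′.sym 𝟙-hom))
    }

  conMap-iso⇔ : (θ : LatCon K) {u v : K′.Carrier} →
                LatCon.rel (ConMapL K′ τ (LatCon.rel θ)) u v ⇔ LatCon.rel θ (σ u) (σ v)
  conMap-iso⇔ θ = mk⇔ pulled pushed
    where
    open LatCon θ
    module Eq = IsEquivalence isEquivalence
    pulled : ∀ {u v} → LatGen K′ (Image τ rel) u v → rel (σ u) (σ v)
    pulled (base (img r)) = rel-resp θ (K.sym (στ _)) (K.sym (στ _)) r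
    pulled (eq e)         = ≈⊆rel (σ-cong e)
    pulled (sym p)        = Eq.sym (pulled p)
    pulled (trans p q)    = Eq.trans (pulled p) (pulled q)
    pulled (∨-c p q)      = rel-resp θ (K.sym (σ-∨ _ _)) (K.sym (σ-∨ _ _))
                              (∨-compat (pulled p) (pulled q))
    pulled (∧-c p q)      = rel-resp θ (K.sym (σ-∧ _ _)) (K.sym (σ-∧ _ _))
                              (∧-compat (pulled p) (pulled q))
    pushed : ∀ {u v} → rel (σ u) (σ v) → LatGen K′ (Image τ rel) u v
    pushed r = trans (eq (K′.sym (τσ _))) (trans (base (img r)) (eq (τσ _)))

dmIso⇒latIso : {N N′ : DeMorganAlgebra ℓ}
               {τ : DeMorganAlgebra.Carrier N → DeMorganAlgebra.Carrier N′} →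
               IsDMIso N N′ τ →
               IsLat01Iso (DeMorganAlgebra.lattice N) (DeMorganAlgebra.lattice N′) τ
dmIso⇒latIso i = record
  { isHom = IsDMIso.isLatHom i
  ; injective = IsDMIso.injective i
  ; surjective = IsDMIso.surjective i
  }

module DMIsoInverse {N N′ : DeMorganAlgebra ℓ}
                    {τ : DeMorganAlgebra.Carrier N → DeMorganAlgebra.Carrier N′}
                    (iso : IsDMIso N N′ τ) where
  private
    module N  = DeMorganAlgebra N
    module N′ = DeMorganAlgebra N′
  open LatIsoInverse (dmIso⇒latIso iso) public
  open SetoidReasoning N′.setoid

  σ-° : ∀ x → σ (x N′.°) N.≈ σ x N.°
  σ-° x = IsDMIso.injective iso (begin
    τ (σ (x N′.°))  ≈⟨ τσ _ ⟩
    x N′.°          ≈⟨ N′.°-cong (N′.sym (τσ x)) ⟩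
    τ (σ x) N′.°    ≈⟨ N′.sym (IsDMIso.°-hom iso _) ⟩
    τ (σ x N.°)     ∎)

  conMapDM-pull : (θ : Con N) {u v : N′.Carrier} →
                  MSCon.rel (ConMapDM N′ τ (MSCon.rel θ)) u v → MSCon.rel θ (σ u) (σ v)
  conMapDM-pull θ = pulled
    where
    open MSCon θ
    module Eq = IsEquivalence isEquivalence
    pulled : ∀ {u v} → MSGen N′.msAlgebra (Image τ rel) u v → rel (σ u) (σ v)
    pulled (base (img r)) = rel-resp latCon (N.sym (στ _)) (N.sym (στ _)) r
    pulled (eq e)         = ≈⊆rel (σ-cong e)
    pulled (sym p)        = Eq.sym (pulled p)
    pulled (trans p q)    = Eq.trans (pulled p) (pulled q)
    pulled (∨-c p q)      = rel-resp latCon (N.sym (σ-∨ _ _)) (N.sym (σ-∨ _ _))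
                              (∨-compat (pulled p) (pulled q))
    pulled (∧-c p q)      = rel-resp latCon (N.sym (σ-∧ _ _)) (N.sym (σ-∧ _ _))
                              (∧-compat (pulled p) (pulled q))
    pulled (°-c p)        = rel-resp latCon (N.sym (σ-° _)) (N.sym (σ-° _))
                              (°-compat (pulled p))

module Transport {M N : DeMorganAlgebra ℓ} {D E : BDLattice ℓ}
  {τ₁ : DeMorganAlgebra.Carrier M → DeMorganAlgebra.Carrier N}
  {τ₂ : BDLattice.Carrier D → BDLattice.Carrier E}
  (i₁ : IsDMIso M N τ₁) (i₂ : IsLat01Iso D E τ₂)
  (g : DeMorganAlgebra.Carrier N → BDLattice.Carrier E)
  (g-cong : ∀ {a b} → DeMorganAlgebra._≈_ N a b → BDLattice._≈_ E (g a) (g b))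
  where
  private
    module I₁ = DMIsoInverse i₁
    module I₂ = LatIsoInverse i₂

  induced : DeMorganAlgebra.Carrier M → BDLattice.Carrier D
  induced a = I₂.σ (g (τ₁ a))

  Lifts : Con M → ConL D → Set ℓ
  Lifts θ₁ θ₂ = ∀ a b → MSCon.rel (ConMapDM N τ₁ (MSCon.rel θ₁)) a b →
                        LatCon.rel (ConMapL E τ₂ (LatCon.rel θ₂)) (g a) (g b)

  InducedBelow : Con M → ConL D → Set ℓ
  InducedBelow θ₁ θ₂ = LatCon.rel (ConMapL D induced (MSCon.rel θ₁)) ⇒ LatCon.rel θ₂

  transport : (θ₁ : Con M) (θ₂ : ConL D) → Lifts θ₁ θ₂ ⇔ InducedBelow θ₁ θ₂
  transport θ₁ θ₂ = mk⇔ to from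
    where
    module θ₂⊆ = Equivalence (conMap⊆⇔ D induced (MSCon.rel θ₁) θ₂)
    module I₂θ₂ {u} {v} = Equivalence (I₂.conMap-iso⇔ θ₂ {u} {v})
    induced-σ₁ : ∀ a → BDLattice._≈_ D (induced (I₁.σ a)) (I₂.σ (g a))
    induced-σ₁ a = I₂.σ-cong (g-cong (I₁.τσ a))
    to : Lifts θ₁ θ₂ → InducedBelow θ₁ θ₂
    to h = θ₂⊆.from (λ {a} {b} r → I₂θ₂.to (h (τ₁ a) (τ₁ b) (base (img r))))
    from : InducedBelow θ₁ θ₂ → Lifts θ₁ θ₂
    from h a b r = I₂θ₂.from
      (rel-resp θ₂ (induced-σ₁ a) (induced-σ₁ b) (θ₂⊆.to h (I₁.conMapDM-pull θ₁ r)))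

∨-distribʳ-∨ : (K : BDLattice ℓ) (a b c : BDLattice.Carrier K) →
               BDLattice._≈_ K (BDLattice._∨_ K (BDLattice._∨_ K a b) c)
                 (BDLattice._∨_ K (BDLattice._∨_ K a c) (BDLattice._∨_ K b c))
∨-distribʳ-∨ K a b c = begin
  (a ∨ b) ∨ c        ≈⟨ ∨-assoc a b c ⟩
  a ∨ (b ∨ c)        ≈⟨ ∨-congˡ (∨-congˡ (≈-sym (≤⇒∨ (≈⇒≤ ≈-refl)))) ⟩
  a ∨ (b ∨ (c ∨ c))  ≈⟨ ∨-congˡ (≈-sym (∨-assoc b c c)) ⟩
  a ∨ ((b ∨ c) ∨ c)  ≈⟨ ∨-congˡ (∨-comm (b ∨ c) c) ⟩
  a ∨ (c ∨ (b ∨ c))  ≈⟨ ≈-sym (∨-assoc a c (b ∨ c)) ⟩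
  (a ∨ c) ∨ (b ∨ c)  ∎
  where open BDLattice K renaming (refl to ≈-refl; sym to ≈-sym)
        open LatticeFacts K
        open SetoidReasoning setoid

∨d-hom : {L : MSAlgebra ℓ} (pr : Principal L) →
         IsLat01Hom (DeMorganAlgebra.lattice (L°° L)) (DL pr) (∨d pr)
∨d-hom {L = L} pr = record
  { cong  = ∨-congʳ
  ; ∨-hom = λ a b → ∨-distribʳ-∨ lattice (proj₁ a) (proj₁ b) d
  ; ∧-hom = λ a b → ∨-distribʳ-∧ d (proj₁ a) (proj₁ b)
  ; 𝟘-hom = ≈-trans (∨-comm 𝟘 d) (∨-identityʳ d)
  ; 𝟙-hom = ≤⇒∨ (x≤𝟙 d)
  }
  where open MSAlgebra L renaming (trans to ≈-trans)
        open Principal pr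
        open LatticeFacts lattice

_×ᴮ_ : BDLattice ℓ → BDLattice ℓ → BDLattice ℓ
K ×ᴮ K′ = record
  { Carrier = K.Carrier × K′.Carrier
  ; _≈_ = λ (a , x) (b , y) → (a K.≈ b) × (x K′.≈ y)
  ; _∨_ = λ (a , x) (b , y) → (a K.∨ b , x K′.∨ y)
  ; _∧_ = λ (a , x) (b , y) → (a K.∧ b , x K′.∧ y)
  ; 𝟘 = K.𝟘 , K′.𝟘
  ; 𝟙 = K.𝟙 , K′.𝟙
  ; isDistributiveLattice = record
    { isLattice = record
      { isEquivalence = record
        { refl  = K.refl , K′.refl
        ; sym   = λ (p , q) → K.sym p , K′.sym q
        ; trans = λ (p , q) (p′ , q′) → K.trans p p′ , K′.trans q q′
        }
      ; ∨-comm  = λ (a , x) (b , y) → K.∨-comm a b , K′.∨-comm x y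
      ; ∨-assoc = λ (a , x) (b , y) (c , z) → K.∨-assoc a b c , K′.∨-assoc x y z
      ; ∨-cong  = λ (p , q) (p′ , q′) → K.∨-cong p p′ , K′.∨-cong q q′
      ; ∧-comm  = λ (a , x) (b , y) → K.∧-comm a b , K′.∧-comm x y
      ; ∧-assoc = λ (a , x) (b , y) (c , z) → K.∧-assoc a b c , K′.∧-assoc x y z
      ; ∧-cong  = λ (p , q) (p′ , q′) → K.∧-cong p p′ , K′.∧-cong q q′
      ; absorptive = (λ (a , x) (b , y) → K.∨-absorbs-∧ a b , K′.∨-absorbs-∧ x y)
                   , (λ (a , x) (b , y) → K.∧-absorbs-∨ a b , K′.∧-absorbs-∨ x y)
      }
    ; ∨-distrib-∧ =
        (λ (a , x) (b , y) (c , z) → K.∨-distribˡ-∧ a b c , K′.∨-distribˡ-∧ x y z)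
      , (λ (a , x) (b , y) (c , z) → K.∨-distribʳ-∧ a b c , K′.∨-distribʳ-∧ x y z)
    ; ∧-distrib-∨ =
        (λ (a , x) (b , y) (c , z) → K.∧-distribˡ-∨ a b c , K′.∧-distribˡ-∨ x y z)
      , (λ (a , x) (b , y) (c , z) → K.∧-distribʳ-∨ a b c , K′.∧-distribʳ-∨ x y z)
    }
  ; ∨-identityʳ = λ (a , x) → K.∨-identityʳ a , K′.∨-identityʳ x
  ; ∧-identityʳ = λ (a , x) → K.∧-identityʳ a , K′.∧-identityʳ x
  }
  where module K  = BDLattice K
        module K′ = BDLattice K′

module Monotone (K : BDLattice ℓ) where
  open BDLattice K
  open LatticeFacts K

  ∨-mono : ∀ {x y x′ y′} → x ≤ x′ → y ≤ y′ → x ∨ y ≤ x′ ∨ y′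
  ∨-mono p q = ≤-lub (≤-trans p (x≤x∨y _ _)) (≤-trans q (y≤x∨y _ _))

  ∧-mono : ∀ {x y x′ y′} → x ≤ x′ → y ≤ y′ → x ∧ y ≤ x′ ∧ y′
  ∧-mono {x} {y} p q =
    ≤-glb (≤-trans (x∧y≤x x y) p)
          (≤-trans (≤-trans (≈⇒≤ (∧-comm x y)) (x∧y≤x y x)) q)

°≈𝟘⇒≈𝟙 : (N : DeMorganAlgebra ℓ) {a : DeMorganAlgebra.Carrier N} →
         DeMorganAlgebra._≈_ N (DeMorganAlgebra._° N a) (DeMorganAlgebra.𝟘 N) →
         DeMorganAlgebra._≈_ N a (DeMorganAlgebra.𝟙 N)
°≈𝟘⇒≈𝟙 N {a} a°≈𝟘 = begin
  a      ≈⟨ ≈-sym (°°-involutive a) ⟩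
  a ° °  ≈⟨ °-cong a°≈𝟘 ⟩
  𝟘 °    ≈⟨ 𝟘° ⟩
  𝟙      ∎
  where open DeMorganAlgebra N renaming (sym to ≈-sym)
        open MSFacts msAlgebra
        open SetoidReasoning setoid

module Construction {M : DeMorganAlgebra ℓ} {D : BDLattice ℓ}
  {φ : DeMorganAlgebra.Carrier M → BDLattice.Carrier D}
  (hφ : IsLat01Hom (DeMorganAlgebra.lattice M) D φ) where
  private
    module M = DeMorganAlgebra M
    module D = BDLattice D
    module P = BDLattice (M.lattice ×ᴮ D)
    module φ = IsLat01Hom hφ
    module FM = LatticeFacts M.lattice
    module FD = LatticeFacts D
    open Monotone D

  Below : P.Carrier → Set ℓ
  Below (a , x) = x D.≤ φ a

  below-∨ : ∀ {u v} → Below u → Below v → Below (u P.∨ v)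
  below-∨ p q = FD.≤-trans (∨-mono p q) (FD.≈⇒≤ (D.sym (φ.∨-hom _ _)))

  below-∧ : ∀ {u v} → Below u → Below v → Below (u P.∧ v)
  below-∧ p q = FD.≤-trans (∧-mono p q) (FD.≈⇒≤ (D.sym (φ.∧-hom _ _)))

  open Restrict (M.lattice ×ᴮ D) Below

  Llat : BDLattice ℓ
  Llat = record
    { Carrier = S
    ; _≈_ = _≈S_
    ; _∨_ = λ u v → (proj₁ u P.∨ proj₁ v) , below-∨ (proj₂ u) (proj₂ v)
    ; _∧_ = λ u v → (proj₁ u P.∧ proj₁ v) , below-∧ (proj₂ u) (proj₂ v)
    ; 𝟘 = (M.𝟘 , D.𝟘) , FD.𝟘≤x _
    ; 𝟙 = (M.𝟙 , D.𝟙) , FD.≈⇒≤ (D.sym φ.𝟙-hom)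
    ; isDistributiveLattice = isDL below-∨ below-∧
    ; ∨-identityʳ = λ u → P.∨-identityʳ (proj₁ u)
    ; ∧-identityʳ = λ u → P.∧-identityʳ (proj₁ u)
    }

  L : MSAlgebra ℓ
  L = record
    { lattice = Llat
    ; _° = λ ((a , _) , _) → (a M.° , φ (a M.°)) , FD.≈⇒≤ D.refl
    ; °-cong = λ (a≈b , _) → M.°-cong a≈b , φ.cong (M.°-cong a≈b)
    ; ≤-°° = λ ((a , _) , x≤φa) →
        M.≤-°° a , FD.≤-trans x≤φa (FD.≈⇒≤ (φ.cong (M.sym (M.°°-involutive a))))
    ; °-∧ = λ ((a , _) , _) ((b , _) , _) →
        M.°-∧ a b , D.trans (φ.cong (M.°-∧ a b)) (φ.∨-hom _ _)
    ; 𝟙° = M.𝟙° , D.trans (φ.cong M.𝟙°) φ.𝟘-hom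
    }

  -- a° = 0 in M exactly when a = 1, so D(L) consists of the pairs (1 , x)
  ≈𝟙⇒°≈𝟘 : ∀ {a} → a M.≈ M.𝟙 → a M.° M.≈ M.𝟘
  ≈𝟙⇒°≈𝟘 a≈𝟙 = M.trans (M.°-cong a≈𝟙) M.𝟙°

  pr : Principal L
  pr = record
    { d = (M.𝟙 , D.𝟘) , FD.𝟘≤x _
    ; D-is-↑d = λ ((a , x) , _) →
        (λ (a°≈𝟘 , _) → FM.≈⇒≤ (M.sym (°≈𝟘⇒≈𝟙 M a°≈𝟘)) , FD.𝟘≤x x)
      , (λ (𝟙≤a , _) → let a°≈𝟘 = ≈𝟙⇒°≈𝟘 (FM.≤-antisym (FM.x≤𝟙 a) 𝟙≤a)
                       in a°≈𝟘 , D.trans (φ.cong a°≈𝟘) φ.𝟘-hom)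
    ; decompose = λ ((a , x) , x≤φa) → decompose-M a , decompose-D a x x≤φa
    }
    where
    decompose-M : ∀ a → a M.≈ a M.° M.° M.∧ (a M.∨ M.𝟙)
    decompose-M a = M.sym (begin
      a M.° M.° M.∧ (a M.∨ M.𝟙)  ≈⟨ M.∧-congˡ (M.trans (M.∨-comm a M.𝟙) (FM.≤⇒∨ (FM.x≤𝟙 a))) ⟩
      a M.° M.° M.∧ M.𝟙          ≈⟨ M.∧-identityʳ _ ⟩
      a M.° M.°                  ≈⟨ M.°°-involutive a ⟩
      a                          ∎)
      where open SetoidReasoning M.setoid
    decompose-D : ∀ a x → x D.≤ φ a → x D.≈ φ (a M.° M.°) D.∧ (x D.∨ D.𝟘)
    decompose-D a x x≤φa = D.sym (begin
      φ (a M.° M.°) D.∧ (x D.∨ D.𝟘)  ≈⟨ D.∧-cong (φ.cong (M.°°-involutive a)) (D.∨-identityʳ x) ⟩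
      φ a D.∧ x                      ≈⟨ D.∧-comm _ _ ⟩
      x D.∧ φ a                      ≈⟨ x≤φa ⟩
      x                              ∎)
      where open SetoidReasoning D.setoid

  τ₁ : M.Carrier → DeMorganAlgebra.Carrier (L°° L)
  τ₁ a = ((a , φ a) , FD.≈⇒≤ D.refl)
       , (M.sym (M.°°-involutive a) , φ.cong (M.sym (M.°°-involutive a)))

  i₁ : IsDMIso M (L°° L) τ₁
  i₁ = record
    { isLatHom = record
      { cong  = λ a≈b → a≈b , φ.cong a≈b
      ; ∨-hom = λ a b → M.refl , φ.∨-hom a b
      ; ∧-hom = λ a b → M.refl , φ.∧-hom a b
      ; 𝟘-hom = M.refl , φ.𝟘-hom
      ; 𝟙-hom = M.refl , φ.𝟙-hom
      }
    ; °-hom = λ _ → M.refl , D.refl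
    ; injective = proj₁
    ; surjective = λ (((a , _) , _) , (_ , x≈φa°°)) →
        a , (M.refl , D.sym (D.trans x≈φa°° (φ.cong (M.°°-involutive a))))
    }

  τ₂ : D.Carrier → BDLattice.Carrier (DL pr)
  τ₂ x = ((M.𝟙 , x) , FD.≤-trans (FD.x≤𝟙 x) (FD.≈⇒≤ (D.sym φ.𝟙-hom)))
       , (M.𝟙° , D.trans (φ.cong M.𝟙°) φ.𝟘-hom)

  i₂ : IsLat01Iso D (DL pr) τ₂
  i₂ = record
    { isHom = record
      { cong  = λ x≈y → M.refl , x≈y
      ; ∨-hom = λ _ _ → M.sym (FM.≤⇒∨ (FM.x≤𝟙 M.𝟙)) , D.refl
      ; ∧-hom = λ _ _ → M.sym (M.∧-identityʳ M.𝟙) , D.refl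
      ; 𝟘-hom = M.refl , D.refl
      ; 𝟙-hom = M.refl , D.refl
      }
    ; injective = proj₂
    ; surjective = λ (((a , x) , _) , (a°≈𝟘 , _)) →
        x , (M.sym (°≈𝟘⇒≈𝟙 M a°≈𝟘) , D.refl)
    }

  open Transport i₁ i₂ (∨d pr) (λ {a} {b} → IsLat01Hom.cong (∨d-hom pr) {a} {b}) public

  induced≈φ : ∀ a → induced a D.≈ φ a
  induced≈φ a = D.∨-identityʳ (φ a)

CutOutByHom : (M : DeMorganAlgebra ℓ) (D : BDLattice ℓ) {ℓa : Level} →
              Pred (Con M × ConL D) ℓa → Set (suc ℓ ⊔ ℓa)
CutOutByHom M D A =
  Σ[ φ ∈ (DeMorganAlgebra.Carrier M → BDLattice.Carrier D) ]
    IsLat01Hom (DeMorganAlgebra.lattice M) D φ ×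
    (∀ (θ₁ : Con M) (θ₂ : ConL D) →
       A (θ₁ , θ₂) ⇔ (LatCon.rel (ConMapL D φ (MSCon.rel θ₁)) ⇒ LatCon.rel θ₂))

representable⇒cutOut : {M : DeMorganAlgebra ℓ} {D : BDLattice ℓ} {ℓa : Level}
                       (A : Pred (Con M × ConL D) ℓa) →
                       Representable {M = M} {D = D} A → CutOutByHom M D A
representable⇒cutOut {M = M} {D = D} A (L , pr , τ₁ , τ₂ , i₁ , i₂ , A⇔pair) =
  induced , induced-hom , λ θ₁ θ₂ → ⇔.trans (A⇔pair θ₁ θ₂) (transport θ₁ θ₂)
  where
  open Transport i₁ i₂ (∨d pr) (λ {a} {b} → IsLat01Hom.cong (∨d-hom pr) {a} {b})
  induced-hom : IsLat01Hom (DeMorganAlgebra.lattice M) D induced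
  induced-hom =
    ∘-hom (∘-hom (IsDMIso.isLatHom i₁) (∨d-hom pr)) (LatIsoInverse.σ-hom i₂)

cutOut⇒representable : {M : DeMorganAlgebra ℓ} {D : BDLattice ℓ} {ℓa : Level}
                       (A : Pred (Con M × ConL D) ℓa) →
                       CutOutByHom M D A → Representable {M = M} {D = D} A
cutOut⇒representable {D = D} A (φ , hφ , A⇔φ) =
  L , pr , τ₁ , τ₂ , i₁ , i₂ , λ θ₁ θ₂ →
    ⇔.trans (A⇔φ θ₁ θ₂)
      (⇔.trans (conMap⊆-resp D φ induced (λ a → BDLattice.sym D (induced≈φ a))
                             (MSCon.rel θ₁) θ₂)
               (⇔.sym (transport θ₁ θ₂)))
  where open Construction hφ

theorem4p1 : {ℓ ℓa : Level} (M : DeMorganAlgebra ℓ) (D : BDLattice ℓ)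
    (A : Pred (Con M × ConL D) ℓa) →
    IsSublattice {M = M} {D = D} A →
    Representable {M = M} {D = D} A
      ⇔ (Σ[ φ ∈ (DeMorganAlgebra.Carrier M → BDLattice.Carrier D) ]
           IsLat01Hom (DeMorganAlgebra.lattice M) D φ ×
           (∀ (θ₁ : Con M) (θ₂ : ConL D) →
              A (θ₁ , θ₂) ⇔ (LatCon.rel (ConMapL D φ (MSCon.rel θ₁)) ⇒ LatCon.rel θ₂)))
theorem4p1 M D A _ = mk⇔ (representable⇒cutOut A) (cutOut⇒representable A)
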